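{- Let $G$ be a finite simple connected graph with $|V(G)|\geq 3$. Let $xy$ be a cut-edge of $G$, and let $G_1$ and $G_2$ be the subgraphs of $G$ induced by the two components of $G-xy$, with $x\in V(G_1)$ and $y\in V(G_2)$. Then $$\sigma^{\boxtimes}_V(G)\leq \max\{\operatorname{ecc}_{G_1}(x),\operatorname{ecc}_{G_2}(y)\}.$$
   Context: For a connected graph $H$ and $u\in V(H)$, $\operatorname{ecc}_H(u)=\max\{d_H(u,v):v\in V(H)\}$. For $l\in\mathbb{N}$, $\mathbb{N}_l=\{1,\dots,l\}$. A lazy $l$-track on $G$ is a surjective $f:\mathbb{N}_l\to V(G)$ such that for each $i\in\{1,\dots,l-1\}$, $f(i)f(i+1)\in E(G)$ or $f(i)=f(i+1)$. For $f,g:\mathbb{N}_l\to V(G)$, $m_G(f,g)=\min\{d_G(f(i),g(i)):i\in\mathbb{N}_l\}$. The strong vertex span $\sigma^{\boxtimes}_V(G)$ is the maximum of $m_G(f,g)$ over all $l\in\mathbb{N}$ and all pairs $f,g$ of lazy $l$-tracks on $G$. -}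

module Defs where

open import Data.Nat using (ℕ; zero; suc; _⊔_; _⊓_; _≤_)
open import Data.Bool using (Bool; true; false; _∧_; _∨_; not; if_then_else_)
open import Data.Fin using (Fin; zero; suc; inject₁)
open import Data.Fin.Properties using (_≟_)
open import Data.List using (List; allFin; foldr; map)
open import Data.Bool.ListAction using (any)
open import Data.Product using (∃)
open import Data.Sum using (_⊎_)
open import Relation.Nullary.Decidable using (⌊_⌋)
open import Relation.Binary.PropositionalEquality using (_≡_)

record Graph (n : ℕ) : Set where
  field
    adj    : Fin n → Fin n → Bool
    sym    : ∀ u v → adj u v ≡ adj v u
    irrefl : ∀ u → adj u u ≡ false
open Graph public

EdgeRel : ℕ → Set
EdgeRel n = Fin n → Fin n → Bool

reach : ∀ {n} → EdgeRel n → ℕ → Fin n → Fin n → Bool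
reach E zero    u v = ⌊ u ≟ v ⌋
reach E (suc k) u v = reach E k u v ∨ any (λ w → reach E k u w ∧ E w v) (allFin _)

-- least p b = least k < b with p k ≡ true, and b if there is none.
least : (ℕ → Bool) → ℕ → ℕ
least p zero    = zero
least p (suc b) = if p zero then zero else suc (least (λ k → p (suc k)) b)

-- Graph distance along E (walks of length < n suffice; value n if unreachable,
-- which never occurs for the connected graphs considered below).
dist : ∀ {n} → EdgeRel n → Fin n → Fin n → ℕ
dist {n} E u v = least (λ k → reach E k u v) n

Connected : ∀ {n} → EdgeRel n → Set
Connected {n} E = ∀ u v → reach E n u v ≡ true

deleteEdge : ∀ {n} → EdgeRel n → Fin n → Fin n → EdgeRel n
deleteEdge E x y u v =
  E u v ∧ not ((⌊ u ≟ x ⌋ ∧ ⌊ v ≟ y ⌋) ∨ (⌊ u ≟ y ⌋ ∧ ⌊ v ≟ x ⌋))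

CutEdge : ∀ {n} → Graph n → Fin n → Fin n → Set
CutEdge {n} G x y = (adj G x y ≡ true) × (reach (deleteEdge (adj G) x y) n x y ≡ false)
  where open import Data.Product using (_×_)

component : ∀ {n} → Graph n → Fin n → Fin n → Fin n → Fin n → Bool
component {n} G x y z v = reach (deleteEdge (adj G) x y) n z v

induced : ∀ {n} → EdgeRel n → (Fin n → Bool) → EdgeRel n
induced E S u v = S u ∧ S v ∧ E u v

-- ecc_H(u) where H is the subgraph of (Fin n, E) induced by S (u ∈ S):
-- maximum of d_H(u,v) over v ∈ S.
ecc : ∀ {n} → EdgeRel n → (Fin n → Bool) → Fin n → ℕ
ecc E S u = foldr _⊔_ 0 (map (λ v → if S v then dist (induced E S) u v else 0) (allFin _))

-- Lazy l-track on G, with l = suc k and ℕ_l identified with Fin (suc k) (0-based).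
-- (l = 0 admits no surjection onto a nonempty vertex set.)
LazyTrack : ∀ {n} → Graph n → (k : ℕ) → (Fin (suc k) → Fin n) → Set
LazyTrack G k f =
  (∀ v → ∃ λ i → f i ≡ v) ×
  (∀ (i : Fin k) → (adj G (f (inject₁ i)) (f (suc i)) ≡ true) ⊎ (f (inject₁ i) ≡ f (suc i)))
  where open import Data.Product using (_×_)

minFin : ∀ {k} → (Fin (suc k) → ℕ) → ℕ
minFin {zero}  h = h zero
minFin {suc k} h = h zero ⊓ minFin (λ i → h (suc i))

mG : ∀ {n k} → Graph n → (Fin (suc k) → Fin n) → (Fin (suc k) → Fin n) → ℕ
mG G f g = minFin (λ i → dist (adj G) (f i) (g i))

-- σ^⊠_V(G) ≤ M : every pair of lazy l-tracks (any l) has m_G(f,g) ≤ M.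
StrongVertexSpan≤ : ∀ {n} → Graph n → ℕ → Set
StrongVertexSpan≤ G M =
  ∀ (k : ℕ) (f g : Fin (suc k) → _) → LazyTrack G k f → LazyTrack G k g → mG G f g ≤ M

module Submission where

-- A lazy track is onto, so it visits both x and y and hence has a step leaving G₁; as xy is the
-- only edge between G₁ and G₂, that step traverses xy. Let c → d be the simultaneous step of the
-- other track. If c ∈ G₁ then d(x, c) ≤ ecc_{G₁}(x); if d ∈ G₂ then d(y, d) ≤ ecc_{G₂}(y);
-- otherwise c → d traverses yx, and the tracks are at distance d(x, y) = 1, which is at most the
-- bound because a third vertex exists.

open import Defs hiding (sym)
open import Data.Nat
  using (ℕ; zero; suc; _≤_; _<_; _+_; _⊔_; _≤′_; ≤′-refl; ≤′-step; z≤n; s≤s; s≤s⁻¹)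
open import Data.Nat.Properties
  using ( ≤-refl; ≤-trans; ≤-reflexive; ≤-<-trans; <⇒≱; ≤⇒≤′; m≤m+n; m<n⇒m<1+n; n<1+n
        ; m≤m⊔n; m≤n⊔m; m⊓n≤m; m⊓n≤n)
open import Data.Fin using (Fin; zero; suc; inject₁)
open import Data.Fin.Properties using (_≟_; any?)
open import Data.Fin.Subset using (Subset; _∈_; _⊂_; ∣_∣)
open import Data.Fin.Subset.Properties using (p⊂q⇒∣p∣<∣q∣; ∣p∣≤n)
open import Data.Bool using (Bool; true; false; _∧_; _∨_; if_then_else_)
import Data.Bool as Bool
open import Data.Bool.Properties using (T-≡; ¬-not; ∧-conicalˡ; ∧-conicalʳ; ∨-zeroʳ)
open import Data.Bool.ListAction using (any)
open import Data.List using (_∷_; allFin; foldr; map)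
open import Data.List.Membership.Propositional using (lose) renaming (_∈_ to _∈ˡ_)
open import Data.List.Membership.Propositional.Properties using (∈-allFin)
open import Data.List.Relation.Unary.Any using (here; there; satisfied)
open import Data.List.Relation.Unary.Any.Properties using (any⁺; any⁻)
open import Data.Vec using (tabulate)
open import Data.Vec.Properties using (lookup∘tabulate; lookup⇒[]=; []=⇒lookup)
open import Data.Product using (∃; _×_; _,_; proj₁; proj₂)
open import Data.Sum using (_⊎_; inj₁; inj₂; [_,_]′; swap)
import Data.Sum as Sum
open import Function using (_∘_; Equivalence)
open import Relation.Nullary using (yes; no; ¬?; contradiction)
open import Relation.Nullary.Decidable using (⌊_⌋; toWitness; fromWitness; decidable-stable; _×-dec_)
open import Relation.Binary using (DecidableEquality)
open import Relation.Binary.PropositionalEquality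
  using (_≡_; _≢_; refl; sym; trans; cong; cong₂; subst; subst₂)

open Equivalence using (to; from)

any-true⁺ : ∀ {A : Set} (p : A → Bool) {a xs} → a ∈ˡ xs → p a ≡ true → any p xs ≡ true
any-true⁺ p a∈xs pa = to T-≡ (any⁺ p (lose a∈xs (from T-≡ pa)))

any-true⁻ : ∀ {A : Set} (p : A → Bool) xs → any p xs ≡ true → ∃ λ a → p a ≡ true
any-true⁻ p xs any≡true with a , pa ← satisfied (any⁻ p xs (from T-≡ any≡true)) = a , to T-≡ pa

≤-foldr-⊔ : ∀ {A : Set} (h : A → ℕ) {a xs} → a ∈ˡ xs → h a ≤ foldr _⊔_ 0 (map h xs)
≤-foldr-⊔ h              (here refl)  = m≤m⊔n _ _
≤-foldr-⊔ h {xs = b ∷ _} (there a∈xs) = ≤-trans (≤-foldr-⊔ h a∈xs) (m≤n⊔m (h b) _)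

minFin≤ : ∀ {k} (h : Fin (suc k) → ℕ) i → minFin h ≤ h i
minFin≤ {zero}  h zero    = ≤-refl
minFin≤ {suc k} h zero    = m⊓n≤m _ _
minFin≤ {suc k} h (suc i) = ≤-trans (m⊓n≤n (h zero) _) (minFin≤ (h ∘ suc) i)

least≤ : ∀ p b {k} → p k ≡ true → least p b ≤ k
least≤ p zero    _  = z≤n
least≤ p (suc b) {k} pk with p zero in p0
... | true = z≤n
least≤ p (suc b) {zero}  pk | false = contradiction (trans (sym p0) pk) λ ()
least≤ p (suc b) {suc k} pk | false = s≤s (least≤ (p ∘ suc) b pk)

least≤bound : ∀ p b → least p b ≤ b
least≤bound p zero = z≤n
least≤bound p (suc b) with p zero
... | true  = z≤n
... | false = s≤s (least≤bound (p ∘ suc) b)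

least-found⊎bound : ∀ p b → p (least p b) ≡ true ⊎ least p b ≡ b
least-found⊎bound p zero = inj₂ refl
least-found⊎bound p (suc b) with p zero in p0
... | true = inj₁ p0
... | false with least-found⊎bound (p ∘ suc) b
...   | inj₁ found = inj₁ found
...   | inj₂ bound = inj₂ (cong suc bound)

≟-true⁻ : ∀ {n} {a b : Fin n} → ⌊ a ≟ b ⌋ ≡ true → a ≡ b
≟-true⁻ p = toWitness (from T-≡ p)

≟∧≟-true⁻ : ∀ {n} {a b c d : Fin n} → ⌊ a ≟ b ⌋ ∧ ⌊ c ≟ d ⌋ ≡ true → a ≡ b × c ≡ d
≟∧≟-true⁻ p = ≟-true⁻ (∧-conicalˡ _ _ p) , ≟-true⁻ (∧-conicalʳ _ _ p)

steps-equal⇒constant : ∀ {A : Set} {k} (h : Fin (suc k) → A) →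
  (∀ t → h (inject₁ t) ≡ h (suc t)) → ∀ i → h i ≡ h zero
steps-equal⇒constant h steps zero = refl
steps-equal⇒constant {k = suc k} h steps (suc i) =
  trans (steps-equal⇒constant (h ∘ suc) (steps ∘ suc) i) (sym (steps zero))

step-differs : ∀ {A : Set} {k} → DecidableEquality A →
  (h : Fin (suc k) → A) {i j : Fin (suc k)} → h i ≢ h j → ∃ λ (t : Fin k) → h (inject₁ t) ≢ h (suc t)
step-differs _≟ᴬ_ h {i} {j} hi≢hj with any? (λ t → ¬? (h (inject₁ t) ≟ᴬ h (suc t)))
... | yes step = step
... | no ¬step = contradiction (trans (constant i) (sym (constant j))) hi≢hj
  where
  constant : ∀ i → h i ≡ h zero
  constant = steps-equal⇒constant h λ t →
    decidable-stable (h (inject₁ t) ≟ᴬ h (suc t)) λ ne → ¬step (t , ne)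

module _ {n} (E : EdgeRel n) where

  reach-refl : ∀ k u → reach E k u u ≡ true
  reach-refl zero    u = to T-≡ (fromWitness refl)
  reach-refl (suc k) u rewrite reach-refl k u = refl

  reach-weaken : ∀ {k u v} → reach E k u v ≡ true → reach E (suc k) u v ≡ true
  reach-weaken r rewrite r = refl

  reach-mono : ∀ {k m u v} → k ≤ m → reach E k u v ≡ true → reach E m u v ≡ true
  reach-mono k≤m = go (≤⇒≤′ k≤m)
    where
    go : ∀ {k m u v} → k ≤′ m → reach E k u v ≡ true → reach E m u v ≡ true
    go ≤′-refl       r = r
    go {m = suc m} (≤′-step k≤m) r = reach-weaken {m} (go k≤m r)

  reach-snoc : ∀ {k u w v} → reach E k u w ≡ true → E w v ≡ true → reach E (suc k) u v ≡ true
  reach-snoc {k} {u} {w} {v} r e =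
    trans (cong (reach E k u v ∨_) (any-true⁺ _ (∈-allFin w) (cong₂ _∧_ r e))) (∨-zeroʳ _)

  reach-suc⁻ : ∀ {k u v} → reach E (suc k) u v ≡ true →
    reach E k u v ≡ true ⊎ ∃ λ w → reach E k u w ≡ true × E w v ≡ true
  reach-suc⁻ {k} {u} {v} r with reach E k u v in r′
  ... | true  = inj₁ refl
  ... | false with w , rw∧e ← any-true⁻ _ (allFin _) r =
    inj₂ (w , ∧-conicalˡ _ _ rw∧e , ∧-conicalʳ _ _ rw∧e)

Saturated : ∀ {n} → EdgeRel n → Fin n → ℕ → Set
Saturated E u s = ∀ v → reach E (suc s) u v ≡ true → reach E s u v ≡ true

module _ {n} (E : EdgeRel n) (u : Fin n) where

  saturated⇒reach-stops : ∀ {s} → Saturated E u s →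
    ∀ j {v} → reach E (j + s) u v ≡ true → reach E s u v ≡ true
  saturated⇒reach-stops sat zero r = r
  saturated⇒reach-stops {s} sat (suc j) {v} r with reach-suc⁻ E {j + s} r
  ... | inj₁ r′           = saturated⇒reach-stops sat j r′
  ... | inj₂ (w , r′ , e) = sat v (reach-snoc E {s} (saturated⇒reach-stops sat j r′) e)

  ball : ℕ → Subset n
  ball k = tabulate (reach E k u)

  ∈-ball⁺ : ∀ {k v} → reach E k u v ≡ true → v ∈ ball k
  ∈-ball⁺ {k} {v} r = lookup⇒[]= v (ball k) (trans (lookup∘tabulate _ v) r)

  ∈-ball⁻ : ∀ {k v} → v ∈ ball k → reach E k u v ≡ true
  ∈-ball⁻ {k} {v} v∈ball = trans (sym (lookup∘tabulate _ v)) ([]=⇒lookup v∈ball)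

  ball-grows⊎saturated : ∀ k → k ≤ ∣ ball k ∣ ⊎ ∃ λ s → s < k × Saturated E u s
  ball-grows⊎saturated zero = inj₁ z≤n
  ball-grows⊎saturated (suc k) with ball-grows⊎saturated k
  ... | inj₂ (s , s<k , sat) = inj₂ (s , m<n⇒m<1+n s<k , sat)
  ... | inj₁ k≤∣ball∣
    with any? (λ v → (reach E (suc k) u v Bool.≟ true) ×-dec (reach E k u v Bool.≟ false))
  ...   | yes (v , new , old) = inj₁ (≤-<-trans k≤∣ball∣ (p⊂q⇒∣p∣<∣q∣ ball⊂ball))
    where
    ball⊂ball : ball k ⊂ ball (suc k)
    ball⊂ball = (λ v∈ball → ∈-ball⁺ {suc k} (reach-weaken E {k} (∈-ball⁻ {k} v∈ball)))
              , v , ∈-ball⁺ {suc k} new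
              , λ v∈ball → contradiction (trans (sym (∈-ball⁻ {k} v∈ball)) old) λ ()
  ...   | no ¬new = inj₂ (k , n<1+n k , saturated)
    where
    saturated : Saturated E u k
    saturated v r with reach E k u v Bool.≟ true
    ... | yes old  = old
    ... | no ¬old  = contradiction (v , r , ¬-not ¬old) ¬new

  -- Pigeonhole: in Fin n the balls cannot grow n + 1 times in a row, so they saturate at some s ≤ n.
  reach-bounded : ∀ {k v} → reach E k u v ≡ true → reach E n u v ≡ true
  reach-bounded {k} r with ball-grows⊎saturated (suc n)
  ... | inj₁ 1+n≤∣ball∣       = contradiction (∣p∣≤n (ball (suc n))) (<⇒≱ 1+n≤∣ball∣)
  ... | inj₂ (s , s<1+n , sat) =
    reach-mono E (s≤s⁻¹ s<1+n) (saturated⇒reach-stops sat k (reach-mono E (m≤m+n k s) r))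

dist≤ : ∀ {n} (E : EdgeRel n) {k u v} → reach E k u v ≡ true → dist E u v ≤ k
dist≤ {n} E r = least≤ _ n r

dist-pos : ∀ {n} (E : EdgeRel n) {u v} → u ≢ v → 0 < dist E u v
dist-pos {suc _} E {u} {v} u≢v with u ≟ v
... | yes u≡v = contradiction u≡v u≢v
... | no _    = s≤s z≤n

module _ {n} {E E′ : EdgeRel n} (E⊆E′ : ∀ {a b} → E a b ≡ true → E′ a b ≡ true) where

  reach-⊆ : ∀ {k u v} → reach E k u v ≡ true → reach E′ k u v ≡ true
  reach-⊆ {zero}          r = r
  reach-⊆ {suc k} {u} {v} r with reach-suc⁻ E {k} r
  ... | inj₁ r′           = reach-weaken E′ {k} (reach-⊆ {k} {u} {v} r′)
  ... | inj₂ (w , r′ , e) = reach-snoc E′ {k} (reach-⊆ {k} {u} {w} r′) (E⊆E′ e)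

  dist-mono : ∀ u v → dist E′ u v ≤ dist E u v
  dist-mono u v with least-found⊎bound (λ k → reach E k u v) n
  ... | inj₁ found     = dist≤ E′ (reach-⊆ {dist E u v} {u} {v} found)
  ... | inj₂ unreached = ≤-trans (least≤bound _ n) (≤-reflexive (sym unreached))

induced⊆ : ∀ {n} (E : EdgeRel n) (S : Fin n → Bool) {a b} →
  induced E S a b ≡ true → E a b ≡ true
induced⊆ E S {a} {b} p = ∧-conicalʳ (S b) _ (∧-conicalʳ (S a) _ p)

dist-induced≤ecc : ∀ {n} (E : EdgeRel n) (S : Fin n → Bool) {u v} →
  S v ≡ true → dist (induced E S) u v ≤ ecc E S u
dist-induced≤ecc E S {u} {v} Sv = subst at-v Sv (≤-foldr-⊔ _ (∈-allFin v))
  where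
  at-v : Bool → Set
  at-v b = (if b then dist (induced E S) u v else 0) ≤ ecc E S u

dist≤ecc : ∀ {n} (E : EdgeRel n) (S : Fin n → Bool) {u v} → S v ≡ true → dist E u v ≤ ecc E S u
dist≤ecc E S {u} {v} Sv =
  ≤-trans (dist-mono {E = induced E S} (induced⊆ E S) u v) (dist-induced≤ecc E S Sv)

module _ {n} (E : EdgeRel n) (x y : Fin n) where

  deleteEdge-cases : ∀ {a b} → E a b ≡ true →
    deleteEdge E x y a b ≡ true ⊎ (a ≡ x × b ≡ y) ⊎ (a ≡ y × b ≡ x)
  deleteEdge-cases {a} {b} e with ⌊ a ≟ x ⌋ ∧ ⌊ b ≟ y ⌋ in xy | ⌊ a ≟ y ⌋ ∧ ⌊ b ≟ x ⌋ in yx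
  ... | true  | _     = inj₂ (inj₁ (≟∧≟-true⁻ xy))
  ... | false | true  = inj₂ (inj₂ (≟∧≟-true⁻ yx))
  ... | false | false = inj₁ (cong (_∧ true) e)

  private
    D : EdgeRel n
    D = deleteEdge E x y

  reach-deleteEdge : ∀ {k v} → reach E k x v ≡ true →
    reach D k x v ≡ true ⊎ reach D k y v ≡ true
  reach-deleteEdge {zero} {v} r with refl ← ≟-true⁻ {a = x} {v} r = inj₁ (reach-refl D 0 x)
  reach-deleteEdge {suc k} {v} r with reach-suc⁻ E {k} r
  ... | inj₁ r′ = Sum.map (reach-weaken D {k}) (reach-weaken D {k}) (reach-deleteEdge {k} {v} r′)
  ... | inj₂ (w , r′ , e) with deleteEdge-cases e
  ...   | inj₂ (inj₁ (_ , refl)) = inj₂ (reach-refl D (suc k) y)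
  ...   | inj₂ (inj₂ (_ , refl)) = inj₁ (reach-refl D (suc k) x)
  ...   | inj₁ d = Sum.map (extend {k}) (extend {k}) (reach-deleteEdge {k} {w} r′)
    where
    extend : ∀ {k z} → reach D k z w ≡ true → reach D (suc k) z v ≡ true
    extend {k} r″ = reach-snoc D {k} r″ d

component-closed : ∀ {n} (G : Graph n) (x y z : Fin n) {a b} →
  component G x y z a ≡ true → deleteEdge (adj G) x y a b ≡ true → component G x y z b ≡ true
component-closed {n} G x y z ca d =
  reach-bounded (deleteEdge (adj G) x y) z {suc n} (reach-snoc _ {n} ca d)

third-vertex : ∀ {n} → 3 ≤ n → (x y : Fin n) → ∃ λ v → v ≢ x × v ≢ y
third-vertex (s≤s (s≤s (s≤s _))) (suc _)        (suc _)        = zero , (λ ()) , (λ ())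
third-vertex (s≤s (s≤s (s≤s _))) zero           zero           = suc zero , (λ ()) , (λ ())
third-vertex (s≤s (s≤s (s≤s _))) zero           (suc zero)     = suc (suc zero) , (λ ()) , (λ ())
third-vertex (s≤s (s≤s (s≤s _))) zero           (suc (suc _))  = suc zero , (λ ()) , (λ ())
third-vertex (s≤s (s≤s (s≤s _))) (suc zero)     zero           = suc (suc zero) , (λ ()) , (λ ())
third-vertex (s≤s (s≤s (s≤s _))) (suc (suc _))  zero           = suc zero , (λ ()) , (λ ())

LazyStep : ∀ {n} → Graph n → Fin n → Fin n → Set
LazyStep G a b = adj G a b ≡ true ⊎ a ≡ b

LazyStep-sym : ∀ {n} (G : Graph n) {a b} → LazyStep G a b → LazyStep G b a
LazyStep-sym G {a} {b} (inj₁ e) = inj₁ (trans (Graph.sym G b a) e)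
LazyStep-sym G         (inj₂ e) = inj₂ (sym e)

module CutEdgeSides {n} (G : Graph n) (3≤n : 3 ≤ n) (connected : Connected (adj G))
                    (x y : Fin n) (cut : CutEdge G x y) where

  private
    A : EdgeRel n
    A = adj G

    X Y : Fin n → Bool
    X = component G x y x
    Y = component G x y y

  bound : ℕ
  bound = ecc A X x ⊔ ecc A Y y

  X-or-Y : ∀ v → X v ≡ true ⊎ Y v ≡ true
  X-or-Y v = reach-deleteEdge A x y {n} {v} (connected x v)

  X-if-not-Y : ∀ {v} → Y v ≡ false → X v ≡ true
  X-if-not-Y {v} Yv with X-or-Y v
  ... | inj₁ Xv = Xv
  ... | inj₂ Yv′ = contradiction (trans (sym Yv′) Yv) λ ()

  X-x : X x ≡ true
  X-x = reach-refl _ n x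

  X-y : X y ≡ false
  X-y = proj₂ cut

  leaving-X : ∀ {a b} → LazyStep G a b → X a ≡ true → X b ≡ false → a ≡ x × b ≡ y
  leaving-X (inj₂ refl) Xa Xb = contradiction (trans (sym Xa) Xb) λ ()
  leaving-X (inj₁ e) Xa Xb with deleteEdge-cases A x y e
  ... | inj₁ d                   = contradiction (trans (sym (component-closed G x y x Xa d)) Xb) λ ()
  ... | inj₂ (inj₁ crosses)      = crosses
  ... | inj₂ (inj₂ (refl , _))   = contradiction (trans (sym Xa) X-y) λ ()

  dist-from-x : ∀ {v} → X v ≡ true → dist A x v ≤ bound
  dist-from-x Xv = ≤-trans (dist≤ecc A X Xv) (m≤m⊔n (ecc A X x) _)

  dist-from-y : ∀ {v} → Y v ≡ true → dist A y v ≤ bound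
  dist-from-y Yv = ≤-trans (dist≤ecc A Y Yv) (m≤n⊔m _ (ecc A Y y))

  -- Here |V(G)| ≥ 3 is used: a third vertex lies at positive distance from x in G₁ or from y in G₂.
  1≤bound : 1 ≤ bound
  1≤bound with v , v≢x , v≢y ← third-vertex 3≤n x y | X-or-Y v
  ... | inj₁ Xv = ≤-trans (dist-pos (induced A X) (v≢x ∘ sym))
                          (≤-trans (dist-induced≤ecc A X Xv) (m≤m⊔n (ecc A X x) _))
  ... | inj₂ Yv = ≤-trans (dist-pos (induced A Y) (v≢y ∘ sym))
                          (≤-trans (dist-induced≤ecc A Y Yv) (m≤n⊔m _ (ecc A Y y)))

  dist-x-y : dist A x y ≤ 1
  dist-x-y = dist≤ A {1} (reach-snoc A {0} (reach-refl A 0 x) (proj₁ cut))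

  X-x≢X-y : X x ≢ X y
  X-x≢X-y Xx≡Xy = contradiction (trans (sym X-x) (trans Xx≡Xy X-y)) λ ()

  near-cut-edge : ∀ {c d} → LazyStep G c d → dist A x c ≤ bound ⊎ dist A y d ≤ bound
  near-cut-edge {c} {d} cd with X c in Xc | Y d in Yd
  ... | true  | _    = inj₁ (dist-from-x Xc)
  ... | false | true = inj₂ (dist-from-y Yd)
  ... | false | false with refl , refl ← leaving-X (LazyStep-sym G cd) (X-if-not-Y Yd) Xc =
    inj₁ (≤-trans dist-x-y 1≤bound)

  near-at-crossing : ∀ {a b c d} → LazyStep G a b → LazyStep G c d → X a ≢ X b →
    dist A a c ≤ bound ⊎ dist A b d ≤ bound
  near-at-crossing {a} {b} ab cd Xa≢Xb with X a in Xa | X b in Xb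
  ... | true  | true  = contradiction refl Xa≢Xb
  ... | false | false = contradiction refl Xa≢Xb
  ... | true  | false with refl , refl ← leaving-X ab Xa Xb = near-cut-edge cd
  ... | false | true  with refl , refl ← leaving-X (LazyStep-sym G ab) Xb Xa =
    swap (near-cut-edge (LazyStep-sym G cd))

  track-crosses : ∀ {k} {f : Fin (suc k) → Fin n} → (∀ v → ∃ λ i → f i ≡ v) →
    ∃ λ i → X (f (inject₁ i)) ≢ X (f (suc i))
  track-crosses {f = f} onto with ix , fix ← onto x | iy , fiy ← onto y =
    step-differs Bool._≟_ (X ∘ f) (subst₂ (λ a b → X a ≢ X b) (sym fix) (sym fiy) X-x≢X-y)

  tracks-meet : ∀ {k f g} → LazyTrack G k f → LazyTrack G k g →
    ∃ λ i → dist A (f i) (g i) ≤ bound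
  tracks-meet (onto , f-steps) (_ , g-steps) with i , crosses ← track-crosses onto =
    [ (inject₁ i ,_) , (suc i ,_) ]′ (near-at-crossing (f-steps i) (g-steps i) crosses)

proposition5p1 : ∀ {n} (G : Graph n) → 3 ≤ n → Connected (adj G) →
    (x y : Fin n) → CutEdge G x y →
    StrongVertexSpan≤ G
      (ecc (adj G) (component G x y x) x ⊔ ecc (adj G) (component G x y y) y)
proposition5p1 G 3≤n connected x y cut k f g f-track g-track =
  let open CutEdgeSides G 3≤n connected x y cut
      (i , close) = tracks-meet f-track g-track
  in ≤-trans (minFin≤ (λ j → dist (adj G) (f j) (g j)) i) close
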